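{- Let $n$ be a positive integer. Let $\Delta_n^1=\{\beta\in B_n:\beta_n>0,\ \operatorname{fmaj}(\beta)\text{ odd}\}$ and $D_n^1=\{\gamma\in D_n:\operatorname{Dmaj}(\gamma)\text{ odd}\}$. Then \[\sum_{\beta\in\Delta_n^1} (-1)^{\ell_B(\beta)}q^{\operatorname{fmaj}(\beta)}=-\sum_{\gamma \in D_n^1} (-1)^{\ell_D(\gamma)}q^{\operatorname{Dmaj}(\gamma)}.\]
   Context: $B_n$ is the group of bijections $\beta$ of $[-n,n]\setminus\{0\}$ with $\beta(-i)=-\beta(i)$, written in window notation $\beta=[\beta_1,\dots,\beta_n]$ with $\beta_i=\beta(i)$. For $\beta\in B_n$: $\operatorname{inv}(\beta)=|\{(i,j): 1\le i<j\le n,\ \beta_i>\beta_j\}|$ (usual order on integers); $\operatorname{N}_1(\beta)=|\{i:\beta_i<0\}|$; $\operatorname{N}_2(\beta)=|\{\{i,j\}: i\neq j,\ \beta_i+\beta_j<0\}|$; $\ell_B(\beta)=\operatorname{inv}(\beta)+\operatorname{N}_1(\beta)+\operatorname{N}_2(\beta)$. The descent set $\operatorname{Des}(\beta)$ is the set of $i\in[n-1]$ with $\beta_i\succ\beta_{i+1}$, where $\prec$ is the total order $-1\prec-2\prec\cdots\prec-n\prec 1\prec 2\prec\cdots\prec n$; $\operatorname{maj}(\beta)=\sum_{i\in\operatorname{Des}(\beta)}i$ and $\operatorname{fmaj}(\beta)=2\operatorname{maj}(\beta)+\operatorname{N}_1(\beta)$. $D_n=\{\gamma\in B_n:\operatorname{N}_1(\gamma)\text{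 even}\}$ with length $\ell_D(\gamma)=\operatorname{inv}(\gamma)+\operatorname{N}_2(\gamma)$. For $\gamma\in D_n$, $|\gamma|_n=[\gamma_1,\dots,\gamma_{n-1},|\gamma_n|]$ and $\operatorname{Dmaj}(\gamma)=\operatorname{fmaj}(|\gamma|_n)$. -}

module Defs where

open import Data.Bool using (Bool; true; false; if_then_else_; _∧_; not)
open import Data.Nat as ℕ using (ℕ; zero; suc)
open import Data.Integer as ℤ using (ℤ; +_; -[1+_]; ∣_∣; _≤ᵇ_)
open import Data.List using (List; []; _∷_; map; concatMap; upTo; filterᵇ; foldr)

-- Elements of B_n are represented by their window [β₁,…,βₙ] as a list of
-- nonzero integers.

infix 4 _<ᵇ_ _≻ᵇ_
_<ᵇ_ : ℤ → ℤ → Bool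
x <ᵇ y = not (y ≤ᵇ x)

isNeg : ℤ → Bool
isNeg x = x <ᵇ + 0

count : {A : Set} → (A → Bool) → List A → ℕ
count p [] = 0
count p (x ∷ xs) = (if p x then 1 else 0) ℕ.+ count p xs

signedVals : ℕ → List ℤ
signedVals n = concatMap (λ i → + (suc i) ∷ -[1+ i ] ∷ []) (upTo n)

windows : ℕ → ℕ → List (List ℤ)
windows n zero = [] ∷ []
windows n (suc k) = concatMap (λ x → map (x ∷_) (windows n k)) (signedVals n)

allᵇ : {A : Set} → (A → Bool) → List A → Bool
allᵇ p [] = true
allᵇ p (x ∷ xs) = p x ∧ allᵇ p xs

absDistinct : List ℤ → Bool
absDistinct [] = true
absDistinct (x ∷ xs) = allᵇ (λ y → not (∣ x ∣ ℕ.≡ᵇ ∣ y ∣)) xs ∧ absDistinct xs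

-- B_n: windows of length n with nonzero entries in [-n,n] whose absolute
-- values are pairwise distinct (hence a permutation of [n]); these are
-- exactly the windows of the signed bijections of [-n,n] \ {0}.
Bn : ℕ → List (List ℤ)
Bn n = filterᵇ absDistinct (windows n n)

inv : List ℤ → ℕ
inv [] = 0
inv (x ∷ xs) = count (λ y → y <ᵇ x) xs ℕ.+ inv xs

N1 : List ℤ → ℕ
N1 = count isNeg

N2 : List ℤ → ℕ
N2 [] = 0
N2 (x ∷ xs) = count (λ y → isNeg (x ℤ.+ y)) xs ℕ.+ N2 xs

ℓB : List ℤ → ℕ
ℓB β = inv β ℕ.+ N1 β ℕ.+ N2 β

ℓD : List ℤ → ℕ
ℓD γ = inv γ ℕ.+ N2 γ

-- x ≻ y in the order -1 ≺ -2 ≺ ⋯ ≺ -n ≺ 1 ≺ 2 ≺ ⋯ ≺ n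
_≻ᵇ_ : ℤ → ℤ → Bool
x ≻ᵇ y with isNeg x | isNeg y
... | true  | true  = ∣ y ∣ ℕ.<ᵇ ∣ x ∣
... | true  | false = false
... | false | true  = true
... | false | false = y <ᵇ x

majFrom : ℕ → List ℤ → ℕ
majFrom i [] = 0
majFrom i (x ∷ []) = 0
majFrom i (x ∷ y ∷ rest) = (if x ≻ᵇ y then i else 0) ℕ.+ majFrom (suc i) (y ∷ rest)

maj : List ℤ → ℕ
maj = majFrom 1

fmaj : List ℤ → ℕ
fmaj β = 2 ℕ.* maj β ℕ.+ N1 β

absLast : List ℤ → List ℤ
absLast [] = []
absLast (x ∷ []) = + ∣ x ∣ ∷ []
absLast (x ∷ y ∷ rest) = x ∷ absLast (y ∷ rest)

Dmaj : List ℤ → ℕ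
Dmaj γ = fmaj (absLast γ)

lastPos : List ℤ → Bool
lastPos [] = false
lastPos (x ∷ []) = + 0 <ᵇ x
lastPos (x ∷ y ∷ rest) = lastPos (y ∷ rest)

odd : ℕ → Bool
odd zero = false
odd (suc k) = not (odd k)

Dn : ℕ → List (List ℤ)
Dn n = filterᵇ (λ γ → not (odd (N1 γ))) (Bn n)

Delta1 : ℕ → List (List ℤ)
Delta1 n = filterᵇ (λ β → lastPos β ∧ odd (fmaj β)) (Bn n)

D1 : ℕ → List (List ℤ)
D1 n = filterᵇ (λ γ → odd (Dmaj γ)) (Dn n)

sumℤ : List ℤ → ℤ
sumℤ = foldr ℤ._+_ (+ 0)

-- Polynomials in q with integer coefficients are compared coefficientwise:
-- coefficient of q^k in  Σ_{β ∈ S} (-1)^{len β} q^{stat β}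
coeff : List (List ℤ) → (List ℤ → ℕ) → (List ℤ → ℕ) → ℕ → ℤ
coeff S len stat k =
  sumℤ (map (λ β → -[1+ 0 ] ℤ.^ len β) (filterᵇ (λ β → stat β ℕ.≡ᵇ k) S))

-- Every γ ∈ D_n^1 has N₁(γ) even, while Dmaj γ = fmaj |γ|_n ≡ N₁(|γ|_n) (mod 2) is odd;
-- hence γ_n < 0, and γ ↦ |γ|_n is a bijection D_n^1 → Δ_n^1 (inverse: negate the last
-- entry) which carries Dmaj to fmaj. For β = α·x with x > 0 and γ = α·(−x), every entry a of α
-- is counted exactly twice among the inversions and negative-sum pairs that x forms in β and
-- −x forms in γ (once for a ≷ x, once for a ≷ −x), so ℓ_B(β) + ℓ_D(γ) ≡ N₁(α) ≡ 1 (mod 2):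
-- corresponding terms have opposite signs.

{-# OPTIONS --safe #-}
module Submission where

open import Defs
open import Data.Nat using (ℕ; _≤_)
open import Data.Integer using (-_)
open import Relation.Binary.PropositionalEquality using (_≡_)

open import Algebra.Bundles using (CommutativeMonoid)
open import Data.Bool using (Bool; true; false; if_then_else_; _∧_; not; _xor_; T)
open import Data.Bool.Properties
  using (T-∧; T-not-≡; not-distribˡ-xor; xor-same; ∧-commutativeMonoid)
open import Data.Empty using (⊥-elim)
open import Data.Integer as ℤ using (ℤ; +_; -[1+_]; ∣_∣; _≤ᵇ_; 0ℤ; 1ℤ; -1ℤ)
import Data.Integer.Properties as ℤ
open import Data.List
  using (List; []; _∷_; [_]; _++_; _∷ʳ_; map; concatMap; filterᵇ; length; upTo; initLast; _∷ʳ′_)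
open import Data.List.Effectful using (module MonadProperties)
open import Data.List.Properties
  using ( ++-identityʳ; map-∘; concatMap-cong; concatMap-map; concatMap-pure; map-concatMap
        ; filter-++; filter-≐)
open import Data.List.Relation.Unary.All as All using (All; []; _∷_)
open import Data.List.Relation.Unary.All.Properties using (all-filter; ∷ʳ⁻)
open import Data.Nat as ℕ using (zero; suc; _+_; _*_)
import Data.Nat.Properties as ℕ
open import Data.Nat.Tactic.RingSolver using (solve-∀)
open import Data.Product using (_,_; proj₂)
open import Data.Sum using (inj₁; inj₂)
open import Function using (_∘_; _⇔_; mk⇔)
open import Function.Bundles using (Equivalence)
open import Relation.Binary.PropositionalEquality
  using (_≢_; _≗_; refl; sym; trans; cong; cong₂; subst; module ≡-Reasoning)
open import Relation.Nullary.Decidable using (T?)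
open import Algebra.Properties.CommutativeSemigroup
  (CommutativeMonoid.commutativeSemigroup ∧-commutativeMonoid) using (x∙yz≈y∙xz)

open ≡-Reasoning

module _ {A : Set} where

  filterᵇ-filterᵇ : ∀ (p q : A → Bool) xs →
    filterᵇ p (filterᵇ q xs) ≡ filterᵇ (λ x → q x ∧ p x) xs
  filterᵇ-filterᵇ p q []       = refl
  filterᵇ-filterᵇ p q (x ∷ xs) with q x
  ... | false = filterᵇ-filterᵇ p q xs
  ... | true with p x
  ...   | true  = cong (x ∷_) (filterᵇ-filterᵇ p q xs)
  ...   | false = filterᵇ-filterᵇ p q xs

  filterᵇ-cong : ∀ {p q : A → Bool} → p ≗ q → filterᵇ p ≗ filterᵇ q
  filterᵇ-cong {p} {q} p≗q =
    filter-≐ (T? ∘ p) (T? ∘ q) ((λ {x} → subst T (p≗q x)) , (λ {x} → subst T (sym (p≗q x))))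

  filterᵇ-concatMap : ∀ {B : Set} (p : A → Bool) (f : B → List A) xs →
    filterᵇ p (concatMap f xs) ≡ concatMap (filterᵇ p ∘ f) xs
  filterᵇ-concatMap p f []       = refl
  filterᵇ-concatMap p f (x ∷ xs) =
    trans (filter-++ (T? ∘ p) (f x) (concatMap f xs))
          (cong (filterᵇ p (f x) ++_) (filterᵇ-concatMap p f xs))

  count-++ : ∀ (p : A → Bool) xs ys → count p (xs ++ ys) ≡ count p xs + count p ys
  count-++ p []       ys = refl
  count-++ p (x ∷ xs) ys =
    trans (cong₂ _+_ refl (count-++ p xs ys)) (sym (ℕ.+-assoc (if p x then 1 else 0) _ _))

  count-cong : ∀ {p q : A → Bool} {xs} → All (λ x → p x ≡ q x) xs → count p xs ≡ count q xs
  count-cong []       = refl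
  count-cong (e ∷ es) = cong₂ _+_ (cong (λ b → if b then 1 else 0) e) (count-cong es)

  count-+-count-not : ∀ (p : A → Bool) xs → count p xs + count (not ∘ p) xs ≡ length xs
  count-+-count-not p []       = refl
  count-+-count-not p (x ∷ xs) with p x
  ... | true  = cong suc (count-+-count-not p xs)
  ... | false = trans (ℕ.+-suc _ _) (cong suc (count-+-count-not p xs))

  T-allᵇ : ∀ {p : A → Bool} xs → T (allᵇ p xs) → All (T ∘ p) xs
  T-allᵇ []       _ = []
  T-allᵇ (x ∷ xs) t with Equivalence.to T-∧ t
  ... | px , pxs = px ∷ T-allᵇ xs pxs

T⇔T⇒≡ : ∀ {a b : Bool} → T a ⇔ T b → a ≡ b
T⇔T⇒≡ {false} {false} _   = refl
T⇔T⇒≡ {false} {true}  a⇔b = ⊥-elim (Equivalence.from a⇔b _)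
T⇔T⇒≡ {true}  {false} a⇔b = ⊥-elim (Equivalence.to a⇔b _)
T⇔T⇒≡ {true}  {true}  _   = refl

odd-+ : ∀ m n → odd (m + n) ≡ odd m xor odd n
odd-+ zero    n = refl
odd-+ (suc m) n = trans (cong not (odd-+ m n)) (not-distribˡ-xor (odd m) (odd n))

odd-2*+ : ∀ k n → odd (2 * k + n) ≡ odd n
odd-2*+ k n = begin
  odd (2 * k + n)              ≡⟨ odd-+ (k + (k + 0)) n ⟩
  odd (k + (k + 0)) xor odd n  ≡⟨ cong (_xor odd n) (odd-+ k (k + 0)) ⟩
  (odd k xor odd (k + 0)) xor odd n
    ≡⟨ cong (λ j → (odd k xor odd j) xor odd n) (ℕ.+-identityʳ k) ⟩
  (odd k xor odd k) xor odd n  ≡⟨ cong (_xor odd n) (xor-same (odd k)) ⟩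
  odd n                        ∎

odd-fmaj : ∀ β → odd (fmaj β) ≡ odd (N1 β)
odd-fmaj β = odd-2*+ (maj β) (N1 β)

-1^-parity : ∀ m → -1ℤ ℤ.^ m ≡ (if odd m then -1ℤ else 1ℤ)
-1^-parity zero = refl
-1^-parity (suc m) rewrite -1^-parity m with odd m
... | true  = refl
... | false = refl

-1^-anti : ∀ m n → T (odd (m + n)) → -1ℤ ℤ.^ m ≡ - (-1ℤ ℤ.^ n)
-1^-anti m n odd-sum rewrite -1^-parity m | -1^-parity n | odd-+ m n
  with odd m | odd n
... | true  | false = refl
... | false | true  = refl

≤ᵇ-flip : ∀ {a b : ℤ} → a ≢ b → (b ≤ᵇ a) ≡ not (a ≤ᵇ b)
≤ᵇ-flip {a} {b} a≢b with a ≤ᵇ b in a≤ᵇb | b ≤ᵇ a in b≤ᵇa | ℤ.≤-total a b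
... | true  | false | _ = refl
... | false | true  | _ = refl
... | true  | true  | _ =
  ⊥-elim (a≢b (ℤ.≤-antisym (ℤ.≤ᵇ⇒≤ (subst T (sym a≤ᵇb) _)) (ℤ.≤ᵇ⇒≤ (subst T (sym b≤ᵇa) _))))
... | false | false | inj₁ a≤b = ⊥-elim (subst T a≤ᵇb (ℤ.≤⇒≤ᵇ a≤b))
... | false | false | inj₂ b≤a = ⊥-elim (subst T b≤ᵇa (ℤ.≤⇒≤ᵇ b≤a))

<ᵇ-flip : ∀ {a b : ℤ} → a ≢ b → (a <ᵇ b) ≡ not (b <ᵇ a)
<ᵇ-flip a≢b = cong not (≤ᵇ-flip a≢b)

isNeg-+ : ∀ a y → isNeg (a ℤ.+ y) ≡ (a <ᵇ - y)
isNeg-+ a y = cong not (T⇔T⇒≡ (mk⇔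
  (λ t → ℤ.≤⇒≤ᵇ (ℤ.0≤i-j⇒j≤i {a} { - y} (subst (0ℤ ℤ.≤_) a+y≡a--y (ℤ.≤ᵇ⇒≤ t))))
  (λ t → ℤ.≤⇒≤ᵇ (subst (0ℤ ℤ.≤_) (sym a+y≡a--y) (ℤ.i≤j⇒0≤j-i { - y} {a} (ℤ.≤ᵇ⇒≤ t))))))
  where
  a+y≡a--y : a ℤ.+ y ≡ a ℤ.- - y
  a+y≡a--y = cong (λ z → a ℤ.+ z) (sym (ℤ.neg-involutive y))

count-<ᵇ-+-count-isNeg : ∀ x α → All (_≢ x) α →
  count (x <ᵇ_) α + count (λ a → isNeg (a ℤ.+ - x)) α ≡ length α
count-<ᵇ-+-count-isNeg x α fresh = begin
  count (x <ᵇ_) α + count (λ a → isNeg (a ℤ.+ - x)) α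
    ≡⟨ cong₂ _+_ refl (count-cong (All.universal a+-x<0⇔a<x α)) ⟩
  count (x <ᵇ_) α + count (_<ᵇ x) α
    ≡⟨ cong₂ _+_ refl (count-cong (All.map <ᵇ-flip fresh)) ⟩
  count (x <ᵇ_) α + count (not ∘ (x <ᵇ_)) α
    ≡⟨ count-+-count-not (x <ᵇ_) α ⟩
  length α
    ∎
  where
  a+-x<0⇔a<x : ∀ a → isNeg (a ℤ.+ - x) ≡ (a <ᵇ x)
  a+-x<0⇔a<x a = trans (isNeg-+ a (- x)) (cong (a <ᵇ_) (ℤ.neg-involutive x))

lastNeg : List ℤ → Bool
lastNeg []             = false
lastNeg (x ∷ [])       = isNeg x
lastNeg (_ ∷ y ∷ rest) = lastNeg (y ∷ rest)

lastNeg-∷ʳ : ∀ α y → lastNeg (α ∷ʳ y) ≡ isNeg y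
lastNeg-∷ʳ []          y = refl
lastNeg-∷ʳ (_ ∷ [])    y = refl
lastNeg-∷ʳ (_ ∷ b ∷ α) y = lastNeg-∷ʳ (b ∷ α) y

lastPos-∷ʳ : ∀ α y → lastPos (α ∷ʳ y) ≡ (+ 0 <ᵇ y)
lastPos-∷ʳ []          y = refl
lastPos-∷ʳ (_ ∷ [])    y = refl
lastPos-∷ʳ (_ ∷ b ∷ α) y = lastPos-∷ʳ (b ∷ α) y

absLast-∷ʳ : ∀ α y → absLast (α ∷ʳ y) ≡ α ∷ʳ + ∣ y ∣
absLast-∷ʳ []          y = refl
absLast-∷ʳ (a ∷ [])    y = refl
absLast-∷ʳ (a ∷ b ∷ α) y = cong (a ∷_) (absLast-∷ʳ (b ∷ α) y)

odd-N1-∷ʳ : ∀ α y → odd (N1 (α ∷ʳ y)) ≡ odd (N1 α) xor isNeg y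
odd-N1-∷ʳ α y rewrite count-++ isNeg α [ y ] | odd-+ (N1 α) (N1 [ y ]) with isNeg y
... | true  = refl
... | false = refl

allᵇ-∷ʳ-cong : ∀ (p : ℤ → Bool) α {y z} → p y ≡ p z → allᵇ p (α ∷ʳ y) ≡ allᵇ p (α ∷ʳ z)
allᵇ-∷ʳ-cong p []      py≡pz = cong (_∧ true) py≡pz
allᵇ-∷ʳ-cong p (a ∷ α) py≡pz = cong (p a ∧_) (allᵇ-∷ʳ-cong p α py≡pz)

absDistinct-∷ʳ-cong : ∀ α {y z} → ∣ y ∣ ≡ ∣ z ∣ → absDistinct (α ∷ʳ y) ≡ absDistinct (α ∷ʳ z)
absDistinct-∷ʳ-cong []      _         = refl
absDistinct-∷ʳ-cong (a ∷ α) ∣y∣≡∣z∣ =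
  cong₂ _∧_ (allᵇ-∷ʳ-cong _ α (cong (λ k → not (∣ a ∣ ℕ.≡ᵇ k)) ∣y∣≡∣z∣))
            (absDistinct-∷ʳ-cong α ∣y∣≡∣z∣)

absDistinct-∷ʳ⇒fresh : ∀ α x → T (absDistinct (α ∷ʳ x)) → All (λ a → ∣ a ∣ ≢ ∣ x ∣) α
absDistinct-∷ʳ⇒fresh []      x _ = []
absDistinct-∷ʳ⇒fresh (a ∷ α) x t with Equivalence.to T-∧ t
... | a-fresh , rest = a≢x ∷ absDistinct-∷ʳ⇒fresh α x rest
  where
  a≢x : ∣ a ∣ ≢ ∣ x ∣
  a≢x e = subst T (Equivalence.to T-not-≡ (proj₂ (∷ʳ⁻ (T-allᵇ (α ∷ʳ x) a-fresh))))
                  (ℕ.≡⇒≡ᵇ _ _ e)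

pairStat-∷ʳ : (f : List ℤ → ℕ) (r : ℤ → ℤ → Bool) →
  (∀ x xs → f (x ∷ xs) ≡ count (r x) xs + f xs) →
  ∀ α y → f (α ∷ʳ y) ≡ f α + count (λ a → r a y) α
pairStat-∷ʳ f r f-∷ []      y = trans (f-∷ y []) (sym (ℕ.+-identityʳ (f [])))
pairStat-∷ʳ f r f-∷ (a ∷ α) y = begin
  f (a ∷ α ∷ʳ y)                                           ≡⟨ f-∷ a (α ∷ʳ y) ⟩
  count (r a) (α ∷ʳ y) + f (α ∷ʳ y)
    ≡⟨ cong₂ _+_ (count-++ (r a) α [ y ]) (pairStat-∷ʳ f r f-∷ α y) ⟩
  (count (r a) α + count (r a) [ y ]) + (f α + count (λ b → r b y) α)
    ≡⟨ shuffle (count (r a) α) (if r a y then 1 else 0) (f α) (count (λ b → r b y) α) ⟩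
  (count (r a) α + f α) + count (λ b → r b y) (a ∷ α)     ≡⟨ cong (_+ _) (sym (f-∷ a α)) ⟩
  f (a ∷ α) + count (λ b → r b y) (a ∷ α)                  ∎
  where
  shuffle : ∀ c i g d → (c + (i + 0)) + (g + d) ≡ (c + g) + (i + d)
  shuffle = solve-∀

inv-∷ʳ : ∀ α y → inv (α ∷ʳ y) ≡ inv α + count (y <ᵇ_) α
inv-∷ʳ = pairStat-∷ʳ inv (λ x y → y <ᵇ x) (λ _ _ → refl)

N2-∷ʳ : ∀ α y → N2 (α ∷ʳ y) ≡ N2 α + count (λ a → isNeg (a ℤ.+ y)) α
N2-∷ʳ = pairStat-∷ʳ N2 (λ x y → isNeg (x ℤ.+ y)) (λ _ _ → refl)

ℓB+ℓD-∷ʳ : ∀ α m → All (λ a → ∣ a ∣ ≢ suc m) α →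
  ℓB (α ∷ʳ + suc m) + ℓD (α ∷ʳ -[1+ m ]) ≡ 2 * (inv α + N2 α + length α) + N1 (α ∷ʳ + suc m)
ℓB+ℓD-∷ʳ α m fresh = begin
  ℓB (α ∷ʳ x) + ℓD (α ∷ʳ - x)
    ≡⟨ cong₂ _+_ (cong₂ _+_ (cong (_+ N1β) (inv-∷ʳ α x)) (N2-∷ʳ α x))
                 (cong₂ _+_ (inv-∷ʳ α (- x)) (N2-∷ʳ α (- x))) ⟩
  ((inv α + above x) + N1β + (N2 α + negSum x))
    + ((inv α + above (- x)) + (N2 α + negSum (- x)))
    ≡⟨ regroup (inv α) (N2 α) N1β (above x) (negSum x) (above (- x)) (negSum (- x)) ⟩
  2 * (inv α + N2 α) + (above x + negSum (- x)) + (above (- x) + negSum x) + N1β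
    ≡⟨ cong₂ (λ u v → 2 * (inv α + N2 α) + u + v + N1β)
             (count-<ᵇ-+-count-isNeg x α (All.map (_∘ cong ∣_∣) fresh))
             (count-<ᵇ-+-count-isNeg (- x) α (All.map (_∘ cong ∣_∣) fresh)) ⟩
  2 * (inv α + N2 α) + length α + length α + N1β
    ≡⟨ collect (inv α + N2 α) (length α) N1β ⟩
  2 * (inv α + N2 α + length α) + N1β
    ∎
  where
  x = + suc m
  N1β = N1 (α ∷ʳ x)
  above negSum : ℤ → ℕ
  above y = count (y <ᵇ_) α
  negSum y = count (λ a → isNeg (a ℤ.+ y)) α
  regroup : ∀ I J N c d c′ d′ →
    ((I + c) + N + (J + d)) + ((I + c′) + (J + d′)) ≡ 2 * (I + J) + (c + d′) + (c′ + d) + N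
  regroup = solve-∀
  collect : ∀ K L N → 2 * K + L + L + N ≡ 2 * (K + L) + N
  collect = solve-∀

oddFmajPerm : List ℤ → Bool
oddFmajPerm β = absDistinct β ∧ odd (fmaj β)

-1^ℓB-anti : ∀ α m → T (oddFmajPerm (α ∷ʳ + suc m)) →
  -1ℤ ℤ.^ ℓB (α ∷ʳ + suc m) ≡ - (-1ℤ ℤ.^ ℓD (α ∷ʳ -[1+ m ]))
-1^ℓB-anti α m t with Equivalence.to T-∧ t
... | distinct , oddFmaj = -1^-anti (ℓB β) (ℓD γ) (subst T (sym parity) oddFmaj)
  where
  β γ : List ℤ
  β = α ∷ʳ + suc m
  γ = α ∷ʳ -[1+ m ]
  parity : odd (ℓB β + ℓD γ) ≡ odd (fmaj β)
  parity = begin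
    odd (ℓB β + ℓD γ)
      ≡⟨ cong odd (ℓB+ℓD-∷ʳ α m (absDistinct-∷ʳ⇒fresh α (+ suc m) distinct)) ⟩
    odd (2 * (inv α + N2 α + length α) + N1 β)  ≡⟨ odd-2*+ (inv α + N2 α + length α) (N1 β) ⟩
    odd (N1 β)                                  ≡⟨ odd-fmaj β ⟨
    odd (fmaj β)                                ∎

-- Listing windows by their last entry puts w·(i+1) right before w·(−i−1), so that Δ_n^1 and
-- the image of D_n^1 under absLast come out as equal lists, in the same order.
windows-∷ʳ : ∀ n k →
  windows n (suc k) ≡ concatMap (λ w → map (w ∷ʳ_) (signedVals n)) (windows n k)
windows-∷ʳ n zero = begin
  concatMap (λ x → [ [ x ] ]) (signedVals n)  ≡⟨ concatMap-map [_] [_] (signedVals n) ⟨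
  concatMap [_] (map [_] (signedVals n))       ≡⟨ concatMap-pure (map [_] (signedVals n)) ⟩
  map [_] (signedVals n)                       ≡⟨ ++-identityʳ _ ⟨
  map [_] (signedVals n) ++ []                 ∎
windows-∷ʳ n (suc k) = begin
  concatMap (λ x → map (x ∷_) (windows n (suc k))) vals
    ≡⟨ concatMap-cong (λ x → cong (map (x ∷_)) (windows-∷ʳ n k)) vals ⟩
  concatMap (λ x → map (x ∷_) (concatMap snocs (windows n k))) vals
    ≡⟨ concatMap-cong (λ x → map-concatMap (x ∷_) snocs (windows n k)) vals ⟩
  concatMap (λ x → concatMap (λ w → map (x ∷_) (map (w ∷ʳ_) vals)) (windows n k)) vals
    ≡⟨ concatMap-cong (λ x → concatMap-cong (λ w → sym (map-∘ vals)) (windows n k)) vals ⟩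
  concatMap (λ x → concatMap (snocs ∘ (x ∷_)) (windows n k)) vals
    ≡⟨ concatMap-cong (λ x → concatMap-map snocs (x ∷_) (windows n k)) vals ⟨
  concatMap (λ x → concatMap snocs (map (x ∷_) (windows n k))) vals
    ≡⟨ MonadProperties.associative vals (λ x → map (x ∷_) (windows n k)) snocs ⟩
  concatMap snocs (windows n (suc k))
    ∎
  where
  vals = signedVals n
  snocs : List ℤ → List (List ℤ)
  snocs w = map (w ∷ʳ_) vals

signedPairs : List ℕ → List ℤ
signedPairs = concatMap (λ i → + suc i ∷ -[1+ i ] ∷ [])

filterᵇ-lastPos-snocs : ∀ (P : List ℤ → Bool) w is →
  filterᵇ (λ β → lastPos β ∧ P β) (map (w ∷ʳ_) (signedPairs is))
    ≡ map absLast (filterᵇ (λ γ → lastNeg γ ∧ P (absLast γ)) (map (w ∷ʳ_) (signedPairs is)))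
filterᵇ-lastPos-snocs P w [] = refl
filterᵇ-lastPos-snocs P w (i ∷ is)
  rewrite lastPos-∷ʳ w (+ suc i) | lastNeg-∷ʳ w (+ suc i)
  with P (w ∷ʳ + suc i) in P[w+]
... | true
  rewrite lastPos-∷ʳ w -[1+ i ] | lastNeg-∷ʳ w -[1+ i ] | absLast-∷ʳ w -[1+ i ] | P[w+]
  = cong₂ _∷_ (sym (absLast-∷ʳ w -[1+ i ])) (filterᵇ-lastPos-snocs P w is)
... | false
  rewrite lastPos-∷ʳ w -[1+ i ] | lastNeg-∷ʳ w -[1+ i ] | absLast-∷ʳ w -[1+ i ] | P[w+]
  = filterᵇ-lastPos-snocs P w is

filterᵇ-lastPos-windows : ∀ (P : List ℤ → Bool) n k →
  filterᵇ (λ β → lastPos β ∧ P β) (windows n k)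
    ≡ map absLast (filterᵇ (λ γ → lastNeg γ ∧ P (absLast γ)) (windows n k))
filterᵇ-lastPos-windows P n zero    = refl
filterᵇ-lastPos-windows P n (suc k) = begin
  filterᵇ pos (windows n (suc k))                  ≡⟨ cong (filterᵇ pos) (windows-∷ʳ n k) ⟩
  filterᵇ pos (concatMap snocs W)                  ≡⟨ filterᵇ-concatMap pos snocs W ⟩
  concatMap (filterᵇ pos ∘ snocs) W
    ≡⟨ concatMap-cong (λ w → filterᵇ-lastPos-snocs P w (upTo n)) W ⟩
  concatMap (map absLast ∘ filterᵇ neg ∘ snocs) W
    ≡⟨ map-concatMap absLast (filterᵇ neg ∘ snocs) W ⟨
  map absLast (concatMap (filterᵇ neg ∘ snocs) W)
    ≡⟨ cong (map absLast) (filterᵇ-concatMap neg snocs W) ⟨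
  map absLast (filterᵇ neg (concatMap snocs W))
    ≡⟨ cong (map absLast ∘ filterᵇ neg) (windows-∷ʳ n k) ⟨
  map absLast (filterᵇ neg (windows n (suc k)))
    ∎
  where
  W = windows n k
  pos neg : List ℤ → Bool
  pos β = lastPos β ∧ P β
  neg γ = lastNeg γ ∧ P (absLast γ)
  snocs : List ℤ → List (List ℤ)
  snocs w = map (w ∷ʳ_) (signedVals n)

Delta1-windows : ∀ n → Delta1 n ≡ filterᵇ (λ β → lastPos β ∧ oddFmajPerm β) (windows n n)
Delta1-windows n = trans (filterᵇ-filterᵇ _ absDistinct (windows n n))
  (filterᵇ-cong (λ β → x∙yz≈y∙xz (absDistinct β) (lastPos β) (odd (fmaj β))) (windows n n))

D1-membership : ∀ γ →
  (absDistinct γ ∧ not (odd (N1 γ))) ∧ odd (Dmaj γ) ≡ lastNeg γ ∧ oddFmajPerm (absLast γ)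
D1-membership γ with initLast γ
... | []      = refl
... | α ∷ʳ′ y
  rewrite absLast-∷ʳ α y | odd-fmaj (α ∷ʳ + ∣ y ∣) | odd-N1-∷ʳ α y | odd-N1-∷ʳ α (+ ∣ y ∣)
        | lastNeg-∷ʳ α y | absDistinct-∷ʳ-cong α {+ ∣ y ∣} {y} refl
  = truthTable (absDistinct (α ∷ʳ y)) (odd (N1 α)) (isNeg y)
  where
  truthTable : ∀ a o b → (a ∧ not (o xor b)) ∧ (o xor false) ≡ b ∧ (a ∧ (o xor false))
  truthTable false false false = refl
  truthTable false false true  = refl
  truthTable false true  false = refl
  truthTable false true  true  = refl
  truthTable true  false false = refl
  truthTable true  false true  = refl
  truthTable true  true  false = refl
  truthTable true  true  true  = refl

D1-windows : ∀ n → D1 n ≡ filterᵇ (λ γ → lastNeg γ ∧ oddFmajPerm (absLast γ)) (windows n n)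
D1-windows n = begin
  filterᵇ (odd ∘ Dmaj) (filterᵇ (not ∘ odd ∘ N1) (filterᵇ absDistinct W))
    ≡⟨ cong (filterᵇ (odd ∘ Dmaj)) (filterᵇ-filterᵇ (not ∘ odd ∘ N1) absDistinct W) ⟩
  filterᵇ (odd ∘ Dmaj) (filterᵇ (λ γ → absDistinct γ ∧ not (odd (N1 γ))) W)
    ≡⟨ filterᵇ-filterᵇ (odd ∘ Dmaj) _ W ⟩
  filterᵇ (λ γ → (absDistinct γ ∧ not (odd (N1 γ))) ∧ odd (Dmaj γ)) W
    ≡⟨ filterᵇ-cong D1-membership W ⟩
  filterᵇ (λ γ → lastNeg γ ∧ oddFmajPerm (absLast γ)) W
    ∎
  where
  W = windows n n

Delta1≡map-absLast-D1 : ∀ n → Delta1 n ≡ map absLast (D1 n)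
Delta1≡map-absLast-D1 n = begin
  Delta1 n                                              ≡⟨ Delta1-windows n ⟩
  filterᵇ (λ β → lastPos β ∧ oddFmajPerm β) (windows n n)
    ≡⟨ filterᵇ-lastPos-windows oddFmajPerm n n ⟩
  map absLast (filterᵇ (λ γ → lastNeg γ ∧ oddFmajPerm (absLast γ)) (windows n n))
    ≡⟨ cong (map absLast) (D1-windows n) ⟨
  map absLast (D1 n)                                    ∎

-- t is uninhabited when γ is empty or its last entry is nonnegative.
D1-sign : ∀ {γ} → T (lastNeg γ ∧ oddFmajPerm (absLast γ)) →
  -1ℤ ℤ.^ ℓB (absLast γ) ≡ - (-1ℤ ℤ.^ ℓD γ)
D1-sign {γ} t with initLast γ
... | α ∷ʳ′ y rewrite lastNeg-∷ʳ α y | absLast-∷ʳ α y with y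
...   | -[1+ m ] = -1^ℓB-anti α m t

D1-anti : ∀ n → All (λ γ → -1ℤ ℤ.^ ℓB (absLast γ) ≡ - (-1ℤ ℤ.^ ℓD γ)) (D1 n)
D1-anti n rewrite D1-windows n =
  All.map (λ {γ} → D1-sign {γ})
          (all-filter (T? ∘ (λ γ → lastNeg γ ∧ oddFmajPerm (absLast γ))) (windows n n))

coeff-map-anti : ∀ (f : List ℤ → List ℤ) (len len′ stat : List ℤ → ℕ) k S →
  All (λ γ → -1ℤ ℤ.^ len (f γ) ≡ - (-1ℤ ℤ.^ len′ γ)) S →
  coeff (map f S) len stat k ≡ - coeff S len′ (stat ∘ f) k
coeff-map-anti f len len′ stat k []      []             = refl
coeff-map-anti f len len′ stat k (γ ∷ S) (anti ∷ antis) with stat (f γ) ℕ.≡ᵇ k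
... | true  = trans (cong₂ ℤ._+_ anti (coeff-map-anti f len len′ stat k S antis))
                    (sym (ℤ.neg-distrib-+ (-1ℤ ℤ.^ len′ γ) (coeff S len′ (stat ∘ f) k)))
... | false = coeff-map-anti f len len′ stat k S antis

lemma4p6 : (n : ℕ) → 1 ≤ n → (k : ℕ) →
    coeff (Delta1 n) ℓB fmaj k ≡ - coeff (D1 n) ℓD Dmaj k
lemma4p6 n _ k = begin
  coeff (Delta1 n) ℓB fmaj k
    ≡⟨ cong (λ S → coeff S ℓB fmaj k) (Delta1≡map-absLast-D1 n) ⟩
  coeff (map absLast (D1 n)) ℓB fmaj k
    ≡⟨ coeff-map-anti absLast ℓB ℓD fmaj k (D1 n) (D1-anti n) ⟩
  - coeff (D1 n) ℓD Dmaj k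
    ∎
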